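{- Let $n>k>0$ and let $A$ be a $k$-splitting of $Q_2^n$. Then for every fixed direction, the number of $(n-k)$-faces of $A$ having that direction is even.
   Context: $Q_2^n=\{0,1\}^n$. An $m$-face of $Q_2^n$ is a tuple $a\in\{0,1,*\}^n$ with exactly $m$ entries $*$, identified with $\{x\in Q_2^n: x_i=a_i$ whenever $a_i\in\{0,1\}\}$; its direction is the set of positions $i$ with $a_i=*$. A $k$-splitting of $Q_2^n$ is a collection of pairwise disjoint $(n-k)$-faces whose union is $Q_2^n$. -}

module Defs where

open import Data.Nat using (ℕ; _∸_)
open import Data.Vec using (count)
open import Data.Vec using (allFin)
open import Data.Vec.Properties using (≡-dec)
open import Data.Bool.Properties using () renaming (_≟_ to _≟ᵇ_)
open import Data.Bool using (Bool; true; false)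
open import Data.Fin using (Fin)
open import Data.Fin.Subset using (Subset; inside; outside; ∣_∣)
open import Data.Vec using (Vec; tabulate; lookup)
open import Data.Product using (∃; _×_)
open import Relation.Binary.PropositionalEquality using (_≡_; _≢_)
open import Relation.Nullary using (¬_)

-- Q₂ⁿ = {0,1}ⁿ, points encoded as Bool vectors (false = 0, true = 1).
Point : ℕ → Set
Point n = Vec Bool n

data Sym : Set where
  b : Bool → Sym
  ⋆ : Sym

Face : ℕ → Set
Face n = Vec Sym n

data _∈ˢ_ : Bool → Sym → Set where
  fixed : ∀ {x} → x ∈ˢ b x
  free  : ∀ {x} → x ∈ˢ ⋆

_∈F_ : ∀ {n} → Point n → Face n → Set
_∈F_ {n} x a = ∀ (i : Fin n) → lookup x i ∈ˢ lookup a i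

isStar : Sym → Bool
isStar (b _) = false
isStar ⋆     = true

direction : ∀ {n} → Face n → Subset n
direction a = tabulate (λ i → isStar (lookup a i))

IsMFace : ∀ {n} → ℕ → Face n → Set
IsMFace m a = ∣ direction a ∣ ≡ m

record IsSplitting (n k N : ℕ) (A : Fin N → Face n) : Set where
  field
    faces    : ∀ i → IsMFace (n ∸ k) (A i)
    disjoint : ∀ i j → i ≢ j → ∀ (x : Point n) → ¬ (x ∈F A i × x ∈F A j)
    covers   : ∀ (x : Point n) → ∃ λ i → x ∈F A i

countDir : ∀ {n N} → (Fin N → Face n) → Subset n → ℕ
countDir {N = N} A D = count (λ i → direction (A i) ≟ D) (allFin N)
  where
  _≟_ : ∀ {n} (x y : Subset n) → Relation.Nullary.Dec (x ≡ y)
  _≟_ = ≡-dec _≟ᵇ_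

-- All counting is modulo 2, in 𝔽₂ = (Bool, xor, ∧). Fix D with ∣D∣ = n − k and let Z be the set
-- of points vanishing on D, so ∣Z∣ = 2ᵏ is even. As the faces of A partition the cube,
-- ∣Z∣ = Σₐ ∣Z ∩ a∣, and ∣Z ∩ a∣ is a product over coordinates of the number of admissible
-- values, hence odd iff direction a ⊆ D and a fixes no coordinate of D to 1. For an
-- (n − k)-face this means direction a = D, so the number of faces with direction D is ≡ ∣Z∣ ≡ 0.
module Submission where

open import Defs
open import Data.Nat using (ℕ; _<_)
open import Data.Nat.Divisibility using (_∣_)
open import Data.Fin using (Fin)
open import Data.Fin.Subset using (Subset)

open import Algebra.Bundles using (CommutativeRing)
open import Data.Bool using (Bool; true; false; not; _∧_; _xor_)
open import Data.Bool.Properties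
  using (xor-∧-commutativeRing; ∧-distribˡ-xor; ∧-distribʳ-xor; ∧-identityʳ; ∧-conicalˡ; ∧-conicalʳ;
         not-involutive; ¬-not)
  renaming (_≟_ to _≟ᵇ_)
open import Data.Empty using (⊥-elim)
open import Data.Fin using (zero; suc; punchIn)
open import Data.Fin.Properties using (punchInᵢ≢i)
open import Data.Fin.Subset using (∣_∣; ⊤; inside; outside)
open import Data.Fin.Subset.Properties using (∣⊤∣≡n)
open import Data.Nat using (zero; suc; _≤_; _∸_; s≤s)
import Data.Nat.Properties as ℕ
open import Data.Nat.Divisibility using (_∣0; ∣-refl; ∣m∣n⇒∣m+n)
open import Data.Product using (_,_)
open import Data.Vec using ([]; _∷_; head; tail; count; tabulate)
open import Data.Vec.Properties using (≡-dec)
open import Function using (id; _∘_)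
open import Relation.Binary.Definitions using (DecidableEquality)
open import Relation.Binary.PropositionalEquality
open import Relation.Nullary using (yes; no; does)
open import Relation.Nullary.Decidable using (dec-false)
open import Relation.Unary using (Pred; Decidable)

open CommutativeRing xor-∧-commutativeRing using (semiring; *-commutativeSemigroup)
open import Algebra.Properties.Semiring.Sum semiring
  using (sum; sum-syntax; sum-cong-≗; sum-replicate-zero; sum-remove; ∑-distrib-+; *-distribˡ-sum)
open import Algebra.Properties.CommutativeSemigroup *-commutativeSemigroup
  using () renaming (interchange to ∧-interchange)

open ≡-Reasoning

∑-zero : ∀ {N} (t : Fin N → Bool) → (∀ i → t i ≡ false) → ∑[ i < N ] t i ≡ false
∑-zero {N} t t≡false = trans (sum-cong-≗ t≡false) (sum-replicate-zero N)

∑-single : ∀ {N} (t : Fin N → Bool) i → t i ≡ true → (∀ j → j ≢ i → t j ≡ false) →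
           ∑[ j < N ] t j ≡ true
∑-single {suc N} t i tᵢ≡true others = begin
  sum t                       ≡⟨ sum-remove {i = i} t ⟩
  t i xor sum (t ∘ punchIn i) ≡⟨ cong₂ _xor_ tᵢ≡true (∑-zero _ (λ j → others _ (punchInᵢ≢i i j))) ⟩
  true                        ∎

∑ᶜ : ∀ {n} → (Point n → Bool) → Bool
∑ᶜ {zero}  f = f []
∑ᶜ {suc n} f = ∑ᶜ (λ xs → f (false ∷ xs)) xor ∑ᶜ (λ xs → f (true ∷ xs))

∑ᶜ-cong : ∀ {n} {f g : Point n → Bool} → f ≗ g → ∑ᶜ f ≡ ∑ᶜ g
∑ᶜ-cong {zero}  f≗g = f≗g []
∑ᶜ-cong {suc n} f≗g = cong₂ _xor_ (∑ᶜ-cong (f≗g ∘ (false ∷_))) (∑ᶜ-cong (f≗g ∘ (true ∷_)))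

∧-distribˡ-∑ᶜ : ∀ {n} c (f : Point n → Bool) → c ∧ ∑ᶜ f ≡ ∑ᶜ (λ x → c ∧ f x)
∧-distribˡ-∑ᶜ {zero}  c f = refl
∧-distribˡ-∑ᶜ {suc n} c f = trans (∧-distribˡ-xor c _ _)
  (cong₂ _xor_ (∧-distribˡ-∑ᶜ c (f ∘ (false ∷_))) (∧-distribˡ-∑ᶜ c (f ∘ (true ∷_))))

∑ᶜ-∧-∷ : ∀ {n} (u : Bool → Bool) (h : Point n → Bool) →
         ∑ᶜ (λ x → u (head x) ∧ h (tail x)) ≡ (u false xor u true) ∧ ∑ᶜ h
∑ᶜ-∧-∷ u h = begin
  ∑ᶜ (λ xs → u false ∧ h xs) xor ∑ᶜ (λ xs → u true ∧ h xs)
    ≡⟨ cong₂ _xor_ (∧-distribˡ-∑ᶜ (u false) h) (∧-distribˡ-∑ᶜ (u true) h) ⟨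
  (u false ∧ ∑ᶜ h) xor (u true ∧ ∑ᶜ h)
    ≡⟨ ∧-distribʳ-xor (∑ᶜ h) (u false) (u true) ⟨
  (u false xor u true) ∧ ∑ᶜ h
    ∎

∑ᶜ-∑ : ∀ {n N} (h : Point n → Fin N → Bool) →
       ∑ᶜ (λ x → ∑[ i < N ] h x i) ≡ ∑[ i < N ] ∑ᶜ (λ x → h x i)
∑ᶜ-∑ {zero}  h = refl
∑ᶜ-∑ {suc n} h = trans (cong₂ _xor_ (∑ᶜ-∑ (h ∘ (false ∷_))) (∑ᶜ-∑ (h ∘ (true ∷_))))
  (sym (∑-distrib-+ (λ i → ∑ᶜ (λ xs → h (false ∷ xs) i)) (λ i → ∑ᶜ (λ xs → h (true ∷ xs) i))))

odd : ℕ → Bool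
odd zero    = false
odd (suc m) = not (odd m)

odd≡false⇒2∣ : ∀ m → odd m ≡ false → 2 ∣ m
odd≡false⇒2∣ zero          _    = 2 ∣0
odd≡false⇒2∣ (suc (suc m)) even =
  ∣m∣n⇒∣m+n ∣-refl (odd≡false⇒2∣ m (trans (sym (not-involutive (odd m))) even))

odd-count : ∀ {a p} {A : Set a} {P : Pred A p} (P? : Decidable P) {N} (f : Fin N → A) →
            odd (count P? (tabulate f)) ≡ ∑[ i < N ] does (P? (f i))
odd-count P? {zero}  f = refl
odd-count P? {suc N} f with does (P? (f zero))
... | true  = cong not (odd-count P? (f ∘ suc))
... | false = odd-count P? (f ∘ suc)

_∈ˢᵇ_ : Bool → Sym → Bool
_     ∈ˢᵇ ⋆       = true
false ∈ˢᵇ b false = true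
false ∈ˢᵇ b true  = false
true  ∈ˢᵇ b false = false
true  ∈ˢᵇ b true  = true

_∈ᵇ_ : ∀ {n} → Point n → Face n → Bool
[]       ∈ᵇ []      = true
(x ∷ xs) ∈ᵇ (s ∷ a) = (x ∈ˢᵇ s) ∧ (xs ∈ᵇ a)

∈ˢᵇ⇒∈ˢ : ∀ x s → x ∈ˢᵇ s ≡ true → x ∈ˢ s
∈ˢᵇ⇒∈ˢ false (b false) _ = fixed
∈ˢᵇ⇒∈ˢ true  (b true)  _ = fixed
∈ˢᵇ⇒∈ˢ _     ⋆         _ = free

∈ˢ⇒∈ˢᵇ : ∀ {x s} → x ∈ˢ s → x ∈ˢᵇ s ≡ true
∈ˢ⇒∈ˢᵇ {false} fixed = refl
∈ˢ⇒∈ˢᵇ {true}  fixed = refl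
∈ˢ⇒∈ˢᵇ         free  = refl

∈ᵇ⇒∈F : ∀ {n} (x : Point n) (a : Face n) → x ∈ᵇ a ≡ true → x ∈F a
∈ᵇ⇒∈F (x ∷ xs) (s ∷ a) x∈a zero    = ∈ˢᵇ⇒∈ˢ x s (∧-conicalˡ _ _ x∈a)
∈ᵇ⇒∈F (x ∷ xs) (s ∷ a) x∈a (suc i) = ∈ᵇ⇒∈F xs a (∧-conicalʳ _ _ x∈a) i

∈F⇒∈ᵇ : ∀ {n} (x : Point n) (a : Face n) → x ∈F a → x ∈ᵇ a ≡ true
∈F⇒∈ᵇ []       []      _   = refl
∈F⇒∈ᵇ (x ∷ xs) (s ∷ a) x∈a =
  cong₂ _∧_ (∈ˢ⇒∈ˢᵇ (x∈a zero)) (∈F⇒∈ᵇ xs a (x∈a ∘ suc))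

vanishesOn : ∀ {n} → Subset n → Point n → Bool
vanishesOn []      []       = true
vanishesOn (d ∷ D) (x ∷ xs) = not (d ∧ x) ∧ vanishesOn D xs

∑ᶜ-vanishesOn≡true⇒≡⊤ : ∀ {n} (D : Subset n) → ∑ᶜ (vanishesOn D) ≡ true → D ≡ ⊤
∑ᶜ-vanishesOn≡true⇒≡⊤ []      _ = refl
∑ᶜ-vanishesOn≡true⇒≡⊤ (d ∷ D) ∑≡true
  with d | trans (sym (∑ᶜ-∧-∷ (λ y → not (d ∧ y)) (vanishesOn D))) ∑≡true
... | true  | ∑D≡true = cong (inside ∷_) (∑ᶜ-vanishesOn≡true⇒≡⊤ D ∑D≡true)
... | false | ()

admissible : Bool → Sym → Bool → Bool
admissible d s y = not (d ∧ y) ∧ (y ∈ˢᵇ s)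

oddSlice : ∀ {n} → Subset n → Face n → Bool
oddSlice []      []      = true
oddSlice (d ∷ D) (s ∷ a) = (admissible d s false xor admissible d s true) ∧ oddSlice D a

∑ᶜ-slice : ∀ {n} (D : Subset n) (a : Face n) →
           ∑ᶜ (λ x → vanishesOn D x ∧ x ∈ᵇ a) ≡ oddSlice D a
∑ᶜ-slice []      []      = refl
∑ᶜ-slice (d ∷ D) (s ∷ a) = begin
  ∑ᶜ (λ x → vanishesOn (d ∷ D) x ∧ x ∈ᵇ (s ∷ a))
    ≡⟨ ∑ᶜ-cong regroup ⟩
  ∑ᶜ (λ x → admissible d s (head x) ∧ (vanishesOn D (tail x) ∧ tail x ∈ᵇ a))
    ≡⟨ ∑ᶜ-∧-∷ (admissible d s) (λ xs → vanishesOn D xs ∧ xs ∈ᵇ a) ⟩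
  (admissible d s false xor admissible d s true) ∧ ∑ᶜ (λ xs → vanishesOn D xs ∧ xs ∈ᵇ a)
    ≡⟨ cong (_ ∧_) (∑ᶜ-slice D a) ⟩
  oddSlice (d ∷ D) (s ∷ a)
    ∎
  where
  regroup : ∀ x → vanishesOn (d ∷ D) x ∧ x ∈ᵇ (s ∷ a)
                ≡ admissible d s (head x) ∧ (vanishesOn D (tail x) ∧ tail x ∈ᵇ a)
  regroup (y ∷ ys) = ∧-interchange (not (d ∧ y)) (vanishesOn D ys) (y ∈ˢᵇ s) (ys ∈ᵇ a)

oddSlice-direction : ∀ {n} (a : Face n) → oddSlice (direction a) a ≡ true
oddSlice-direction []            = refl
oddSlice-direction (b false ∷ a) = oddSlice-direction a
oddSlice-direction (b true  ∷ a) = oddSlice-direction a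
oddSlice-direction (⋆       ∷ a) = oddSlice-direction a

oddSlice⇒∣direction∣≤ : ∀ {n} (D : Subset n) (a : Face n) → oddSlice D a ≡ true →
                        ∣ direction a ∣ ≤ ∣ D ∣
oddSlice⇒∣direction∣≤ []             []            _   = ℕ.≤-refl
oddSlice⇒∣direction∣≤ (inside  ∷ D) (b false ∷ a) odd = ℕ.m≤n⇒m≤1+n (oddSlice⇒∣direction∣≤ D a odd)
oddSlice⇒∣direction∣≤ (inside  ∷ D) (⋆       ∷ a) odd = s≤s (oddSlice⇒∣direction∣≤ D a odd)
oddSlice⇒∣direction∣≤ (outside ∷ D) (b false ∷ a) odd = oddSlice⇒∣direction∣≤ D a odd
oddSlice⇒∣direction∣≤ (outside ∷ D) (b true  ∷ a) odd = oddSlice⇒∣direction∣≤ D a odd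

oddSlice⇒direction≡ : ∀ {n} (D : Subset n) (a : Face n) → oddSlice D a ≡ true →
                      ∣ direction a ∣ ≡ ∣ D ∣ → direction a ≡ D
oddSlice⇒direction≡ []             []            _   _  = refl
oddSlice⇒direction≡ (inside  ∷ D) (b false ∷ a) odd eq =
  ⊥-elim (ℕ.<⇒≢ (s≤s (oddSlice⇒∣direction∣≤ D a odd)) eq)
oddSlice⇒direction≡ (inside  ∷ D) (⋆       ∷ a) odd eq =
  cong (inside ∷_) (oddSlice⇒direction≡ D a odd (ℕ.suc-injective eq))
oddSlice⇒direction≡ (outside ∷ D) (b false ∷ a) odd eq = cong (outside ∷_) (oddSlice⇒direction≡ D a odd eq)
oddSlice⇒direction≡ (outside ∷ D) (b true  ∷ a) odd eq = cong (outside ∷_) (oddSlice⇒direction≡ D a odd eq)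

_≟ˢ_ : ∀ {n} → DecidableEquality (Subset n)
_≟ˢ_ = ≡-dec _≟ᵇ_

oddSlice-sameSize : ∀ {n} (D : Subset n) (a : Face n) → ∣ direction a ∣ ≡ ∣ D ∣ →
                    oddSlice D a ≡ does (direction a ≟ˢ D)
oddSlice-sameSize D a sameSize with direction a ≟ˢ D
... | yes refl    = oddSlice-direction a
... | no  dir≢D = ¬-not (dir≢D ∘ λ odd → oddSlice⇒direction≡ D a odd sameSize)

module _ {n k N} {A : Fin N → Face n} (split : IsSplitting n k N A) where
  open IsSplitting split

  ∑-∈ᵇ-splitting : ∀ x → ∑[ i < N ] (x ∈ᵇ A i) ≡ true
  ∑-∈ᵇ-splitting x with covers x
  ... | i , x∈Aᵢ = ∑-single _ i (∈F⇒∈ᵇ x (A i) x∈Aᵢ)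
    (λ j j≢i → ¬-not (λ x∈Aⱼ → disjoint j i j≢i x (∈ᵇ⇒∈F x (A j) x∈Aⱼ , x∈Aᵢ)))

  ∑-oddSlice-splitting : ∀ D → ∑[ i < N ] oddSlice D (A i) ≡ ∑ᶜ (vanishesOn D)
  ∑-oddSlice-splitting D = begin
    ∑[ i < N ] oddSlice D (A i)
      ≡⟨ sum-cong-≗ (λ i → ∑ᶜ-slice D (A i)) ⟨
    ∑[ i < N ] ∑ᶜ (λ x → vanishesOn D x ∧ x ∈ᵇ A i)
      ≡⟨ ∑ᶜ-∑ (λ x i → vanishesOn D x ∧ x ∈ᵇ A i) ⟨
    ∑ᶜ (λ x → ∑[ i < N ] (vanishesOn D x ∧ x ∈ᵇ A i))
      ≡⟨ ∑ᶜ-cong (λ x → *-distribˡ-sum (vanishesOn D x) (λ i → x ∈ᵇ A i)) ⟨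
    ∑ᶜ (λ x → vanishesOn D x ∧ ∑[ i < N ] (x ∈ᵇ A i))
      ≡⟨ ∑ᶜ-cong (λ x → trans (cong (vanishesOn D x ∧_) (∑-∈ᵇ-splitting x)) (∧-identityʳ _)) ⟩
    ∑ᶜ (vanishesOn D)
      ∎

proposition5 : ∀ (n k N : ℕ) → 0 < k → k < n → (A : Fin N → Face n) → IsSplitting n k N A → (D : Subset n) → 2 ∣ countDir A D
proposition5 n k N 0<k k<n A split D =
  odd≡false⇒2∣ (countDir A D) (trans (odd-count (λ i → direction (A i) ≟ˢ D) id) ∑-direction≡false)
  where
  open IsSplitting split

  ∑-direction≡false : ∑[ i < N ] does (direction (A i) ≟ˢ D) ≡ false
  ∑-direction≡false with ∣ D ∣ ℕ.≟ n ∸ k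
  ... | no ∣D∣≢n∸k = ∑-zero _ (λ i → dec-false (direction (A i) ≟ˢ D)
          (λ dir≡D → ∣D∣≢n∸k (trans (cong ∣_∣ (sym dir≡D)) (faces i))))
  ... | yes ∣D∣≡n∸k = begin
    ∑[ i < N ] does (direction (A i) ≟ˢ D)
      ≡⟨ sum-cong-≗ (λ i → oddSlice-sameSize D (A i) (trans (faces i) (sym ∣D∣≡n∸k))) ⟨
    ∑[ i < N ] oddSlice D (A i)
      ≡⟨ ∑-oddSlice-splitting split D ⟩
    ∑ᶜ (vanishesOn D)
      ≡⟨ ¬-not (D≢⊤ ∘ ∑ᶜ-vanishesOn≡true⇒≡⊤ D) ⟩
    false
      ∎
    where
    D≢⊤ : D ≢ ⊤
    D≢⊤ D≡⊤ = ℕ.<⇒≢ (ℕ.∸-monoʳ-< 0<k (ℕ.<⇒≤ k<n))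
      (trans (sym ∣D∣≡n∸k) (trans (cong ∣_∣ D≡⊤) (∣⊤∣≡n n)))
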